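{- Let $T,U$ be independent indeterminates and $C:=\mathbb{Q}(T,U)$. Define polynomials $h_n\in\mathbb{Z}[T,U]$ by $h_0:=T$ and $h_{n+1}:=h_n^2-2U^{2^n}$ for $n\ge 0$, and for $n\ge 0$ put $$S_n(T,U):=\sum_{0\le m\le n}\frac{U^{2^m}}{h_0h_1\cdots h_m}\in C.$$ Let $F(X):=X-f(X)\big/\frac{df}{dX}(X)=\frac{X^2-U}{2X-T}\in C(X)$ be the Newton iterator of $f(X)=X^2-TX+U$, let $F^{(0)}(X):=X$ and let $F^{(n)}$ denote the $n$-fold iterate of $F$. Define elements of $C$ by $a_0:=0$, $a_n:=U^{ -1}T$ for odd $n\ge1$, $a_n:=-T$ for even $n\ge2$; and $b_n:=T$ for even $n\ge0$, $b_n:=-U^{ -1}T$ for odd $n\ge1$. Then for every $n\ge 0$ the identities $$F^{(n+1)}(0)=S_n(T,U)=[0;a_1,a_2,\ldots,a_{2^{n+1}-1}],\qquad F^{(n+1)}(T)=T-S_n(T,U)=[b_0;b_1,b_2,\ldots,b_{2^{n+1}-1}]$$ hold in the field $C$.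
   Context: For elements $c_0,\dots,c_m$ of a field, $[c_0;c_1,\ldots,c_m]$ denotes the finite continued fraction $c_0+\cfrac{1}{c_1+\cfrac{1}{\ddots+\cfrac{1}{c_m}}}$. -}

module Defs where

open import Data.Nat as ℕ using (ℕ; zero; suc; _≟_)
open import Data.Integer as ℤ using (ℤ; +_)
open import Data.List using (List; []; _∷_; _++_; map; concatMap)
open import Data.Product using (_×_; _,_)
open import Data.Unit using (⊤)
open import Relation.Nullary using (¬_; yes; no)
open import Relation.Binary.PropositionalEquality using (_≡_)

-- A polynomial is a finite formal sum of monomials c·T^i·U^j, represented
-- as a list of triples (c , i , j).

Mono : Set
Mono = ℤ × ℕ × ℕ

Poly : Set
Poly = List Mono

coeff : Poly → ℕ → ℕ → ℤ
coeff [] i j = + 0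
coeff ((c , a , b) ∷ p) i j with a ≟ i | b ≟ j
... | yes _ | yes _ = c ℤ.+ coeff p i j
... | _     | _     = coeff p i j

_≈P_ : Poly → Poly → Set
p ≈P q = ∀ i j → coeff p i j ≡ coeff q i j

IsZeroP : Poly → Set
IsZeroP p = ∀ i j → coeff p i j ≡ + 0

infixl 6 _+P_ _-P_
infixl 7 _*P_

_+P_ : Poly → Poly → Poly
p +P q = p ++ q

-P_ : Poly → Poly
-P p = map (λ { (c , a , b) → (ℤ.- c , a , b) }) p

_-P_ : Poly → Poly → Poly
p -P q = p +P (-P q)

mulMono : Mono → Mono → Mono
mulMono (c , a , b) (d , a' , b') = (c ℤ.* d , a ℕ.+ a' , b ℕ.+ b')

_*P_ : Poly → Poly → Poly
p *P q = concatMap (λ m → map (mulMono m) q) p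

constP : ℤ → Poly
constP c = (c , 0 , 0) ∷ []

0P 1P TP UP : Poly
0P = []
1P = constP (+ 1)
TP = (+ 1 , 1 , 0) ∷ []
UP = (+ 1 , 0 , 1) ∷ []

_^P_ : Poly → ℕ → Poly
p ^P zero = 1P
p ^P suc k = p *P (p ^P k)

-- The field C = ℚ(T,U) = Frac(ℤ[T,U]), as formal fractions num/den with
-- the usual cross-multiplication equality.  The inverse is the formal swap;
-- it is only ever meaningful when applied to a nonzero element, and every
-- use of it below comes with an explicit definedness (nonzero) condition.

record C : Set where
  constructor _/_
  field
    num : Poly
    den : Poly
open C public

infix 4 _≈_
_≈_ : C → C → Set
x ≈ y = (num x *P den y) ≈P (num y *P den x)

Nonzero : C → Set
Nonzero x = ¬ IsZeroP (num x)

infixl 6 _+_ _-_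
infixl 7 _*_

ι : Poly → C
ι p = p / 1P

_+_ : C → C → C
x + y = ((num x *P den y) +P (num y *P den x)) / (den x *P den y)

-_ : C → C
- x = (-P num x) / den x

_-_ : C → C → C
x - y = x + (- y)

_*_ : C → C → C
x * y = (num x *P num y) / (den x *P den y)

inv : C → C
inv x = den x / num x

0C 1C Tc Uc : C
0C = ι 0P
1C = ι 1P
Tc = ι TP
Uc = ι UP

h : ℕ → Poly
h zero = TP
h (suc n) = (h n *P h n) -P (constP (+ 2) *P (UP ^P (2 ℕ.^ n)))

prodH : ℕ → Poly
prodH zero = h zero
prodH (suc m) = prodH m *P h (suc m)

Sterm : ℕ → C
Sterm m = (UP ^P (2 ℕ.^ m)) / prodH m

S : ℕ → C
S zero = Sterm zero
S (suc n) = S n + Sterm (suc n)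

f : C → C
f x = (x * x) - (Tc * x) + Uc

df : C → C
df x = (ι (constP (+ 2)) * x) - Tc

F : C → C
F x = x - (f x * inv (df x))

iterF : ℕ → C → C
iterF zero x = x
iterF (suc n) x = F (iterF n x)

IterDefined : ℕ → C → Set
IterDefined zero x = ⊤
IterDefined (suc n) x = IterDefined n x × Nonzero (df (iterF n x))

-- Finite continued fractions: cf c i k = [c i ; c (i+1), …, c (i+k)]

cf : (ℕ → C) → ℕ → ℕ → C
cf c i zero = c i
cf c i (suc k) = c i + inv (cf c (suc i) k)

CFDefined : (ℕ → C) → ℕ → ℕ → Set
CFDefined c i zero = ⊤
CFDefined c i (suc k) = CFDefined c (suc i) k × Nonzero (cf c (suc i) k)

a : ℕ → C
a zero = 0C
a (suc zero) = Tc * inv Uc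
a (suc (suc zero)) = - Tc
a (suc (suc (suc n))) = a (suc n)

b : ℕ → C
b zero = Tc
b (suc zero) = - (Tc * inv Uc)
b (suc (suc n)) = b n

lastIdx : ℕ → ℕ
lastIdx n = (2 ℕ.^ suc n) ℕ.∸ 1

module Submission where

-- In ℤ[T,U][η] with η² = h₁ η − U², write z = c + d η as the pair (c , d) and let numer z = d U − c and
-- denom z = d T.  Multiplying z by η appends one
-- period a₁, a₂ to a continued fraction, so numer (η^k) / denom (η^k) = [0; a₁, …, a_{2k−1}].  Replacing
-- z by z² is one Newton step, F (numer z / denom z) = numer (z²) / denom (z²), so F^{(n+1)}(0) is the
-- fraction of η^{2^n}.  Since the trace and norm of η^{2^n} are h_{n+1} and U^{2^{n+1}}, and
-- h₀ ⋯ h_n = denom (η^{2^n}), the recursion S_{n+1} = S_n + U^{2^{n+1}} / (h₀ ⋯ h_{n+1}) is the same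
-- squaring.  Starting at T instead of 0 replaces each fraction r by T − r, i.e. negates a₁, a₂, ….

open import Algebra.Bundles using (CommutativeRing; RawRing)
open import Algebra.Consequences.Setoid using (comm∧idˡ⇒id; comm∧invˡ⇒inv; comm∧distrˡ⇒distrʳ)
import Algebra.Properties.CommutativeSemigroup as CommutativeSemigroupProperties
import Algebra.Properties.Ring as RingProperties
import Algebra.Solver.Ring
open import Algebra.Solver.Ring.AlmostCommutativeRing using (fromCommutativeRing; _-Raw-AlmostCommutative⟶_)
open import Data.Empty using (⊥-elim)
open import Data.Fin using (#_)
open import Data.Integer using (ℤ; +_; 0ℤ; 1ℤ; -1ℤ; ∣_∣; +-*-rawRing)
  renaming (_+_ to _+ℤ_; _*_ to _*ℤ_; -_ to -ℤ_; _≟_ to _≟ℤ_)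
import Data.Integer.Properties as ℤP
open import Data.Integer.Solver using (module +-*-Solver)
open import Data.List using ([]; _∷_; _++_; map; concatMap)
import Data.List.Properties as List
open import Data.Maybe using (Maybe; just; nothing)
open import Data.Nat as ℕ using (ℕ; zero; suc; _∸_; _^_)
import Data.Nat.Properties as ℕP
open import Data.Product using (Σ; _×_; _,_; proj₁; proj₂)
open import Data.Product.Relation.Binary.Pointwise.NonDependent using (Pointwise; ×-setoid)
open import Data.Sum using (_⊎_; inj₁; inj₂)
open import Data.Unit using (tt)
open import Data.Vec using (Vec; []; _∷_)
open import Data.Vec.Relation.Binary.Pointwise.Inductive as VecPointwise using ([]; _∷_)
  renaming (Pointwise to VecPointwise)
open import Function using (_∘_; case_of_)
open import Level using (0ℓ)
open import Relation.Binary.Bundles using (Setoid)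
open import Relation.Binary.PropositionalEquality
import Relation.Binary.Reasoning.Setoid as SetoidReasoning
open import Relation.Binary.Structures using (IsEquivalence)
open import Relation.Nullary using (yes; no)

open CommutativeSemigroupProperties ℤP.+-commutativeSemigroup using (interchange)
open CommutativeSemigroupProperties ℤP.*-commutativeSemigroup using () renaming (interchange to *-interchange)

module QuadraticExtension (R : RawRing 0ℓ 0ℓ) (T U h₁ : RawRing.Carrier R) where

  open RawRing R

  infixl 7 _⊗_

  _⊗_ : Carrier × Carrier → Carrier × Carrier → Carrier × Carrier
  (c , d) ⊗ (c' , d') = c * c' + - (d * d' * (U * U)) , c * d' + d * c' + d * d' * h₁

  η : Carrier × Carrier
  η = 0# , 1#

  η^ : ℕ → Carrier × Carrier
  η^ zero    = 1# , 0#
  η^ (suc k) = η ⊗ η^ k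

  trace norm numer denom : Carrier × Carrier → Carrier
  trace (c , d) = (1# + 1#) * c + d * h₁
  norm  (c , d) = c * c + c * d * h₁ + d * d * (U * U)
  numer (c , d) = d * U + - c
  denom (c , d) = d * T

-- Opened only here: inside QuadraticExtension its operators on C would clash with those of RawRing.
open import Defs

-- The ring ℤ[T,U]

δ : ℕ → ℕ → ℤ
δ zero    zero    = 1ℤ
δ zero    (suc _) = 0ℤ
δ (suc _) zero    = 0ℤ
δ (suc a) (suc i) = δ a i

step : ℕ → ℕ → ℤ
step zero    _       = 1ℤ
step (suc _) zero    = 0ℤ
step (suc a) (suc i) = step a i

δ-refl : ∀ a → δ a a ≡ 1ℤ
δ-refl zero    = refl
δ-refl (suc a) = δ-refl a

δ-≢ : ∀ {a i} → a ≢ i → δ a i ≡ 0ℤ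
δ-≢ {zero}  {zero}  a≢i = ⊥-elim (a≢i refl)
δ-≢ {zero}  {suc _} _   = refl
δ-≢ {suc _} {zero}  _   = refl
δ-≢ {suc _} {suc _} a≢i = δ-≢ (a≢i ∘ cong suc)

δ-+ : ∀ a a' i → δ (a ℕ.+ a') i ≡ step a i *ℤ δ a' (i ∸ a)
δ-+ zero    a' i       = sym (ℤP.*-identityˡ _)
δ-+ (suc a) a' zero    = refl
δ-+ (suc a) a' (suc i) = δ-+ a a' i

monomialCoeff : Mono → ℕ → ℕ → ℤ
monomialCoeff (c , a , b) i j = δ a i *ℤ (δ b j *ℤ c)

coeff-∷ : ∀ m p i j → coeff (m ∷ p) i j ≡ monomialCoeff m i j +ℤ coeff p i j
coeff-∷ (c , a , b) p i j with a ℕ.≟ i | b ℕ.≟ j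
... | yes refl | yes refl rewrite δ-refl a | δ-refl b | ℤP.*-identityˡ c | ℤP.*-identityˡ c = refl
... | yes refl | no b≢j   rewrite δ-refl a | δ-≢ b≢j = sym (ℤP.+-identityˡ _)
... | no a≢i   | _        rewrite δ-≢ a≢i = sym (ℤP.+-identityˡ _)

∑ : Poly → (Mono → ℤ) → ℤ
∑ []      g = 0ℤ
∑ (m ∷ p) g = g m +ℤ ∑ p g

infix 5 ∑
syntax ∑ p (λ m → e) = ∑[ m ∈ p ] e

coeff≡∑ : ∀ p i j → coeff p i j ≡ ∑[ m ∈ p ] monomialCoeff m i j
coeff≡∑ []      i j = refl
coeff≡∑ (m ∷ p) i j = trans (coeff-∷ m p i j) (cong (monomialCoeff m i j +ℤ_) (coeff≡∑ p i j))

∑-cong : ∀ p {g g'} → (∀ m → g m ≡ g' m) → ∑ p g ≡ ∑ p g'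
∑-cong []      g≗g' = refl
∑-cong (m ∷ p) g≗g' = cong₂ _+ℤ_ (g≗g' m) (∑-cong p g≗g')

∑-++ : ∀ p q g → ∑ (p ++ q) g ≡ ∑ p g +ℤ ∑ q g
∑-++ []      q g = sym (ℤP.+-identityˡ _)
∑-++ (m ∷ p) q g = trans (cong (g m +ℤ_) (∑-++ p q g)) (sym (ℤP.+-assoc (g m) _ _))

∑-map : ∀ f p g → ∑ (map f p) g ≡ ∑ p (g ∘ f)
∑-map f []      g = refl
∑-map f (m ∷ p) g = cong (g (f m) +ℤ_) (∑-map f p g)

∑-concatMap : ∀ k p g → ∑ (concatMap k p) g ≡ ∑[ m ∈ p ] ∑ (k m) g
∑-concatMap k []      g = refl
∑-concatMap k (m ∷ p) g = trans (∑-++ (k m) (concatMap k p) g) (cong (∑ (k m) g +ℤ_) (∑-concatMap k p g))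

∑-0 : ∀ p → ∑ p (λ _ → 0ℤ) ≡ 0ℤ
∑-0 []      = refl
∑-0 (m ∷ p) = trans (ℤP.+-identityˡ _) (∑-0 p)

∑-+ : ∀ p g g' → ∑[ m ∈ p ] (g m +ℤ g' m) ≡ ∑ p g +ℤ ∑ p g'
∑-+ []      g g' = refl
∑-+ (m ∷ p) g g' = trans (cong (g m +ℤ g' m +ℤ_) (∑-+ p g g')) (interchange (g m) (g' m) (∑ p g) (∑ p g'))

∑-neg : ∀ p g → ∑[ m ∈ p ] -ℤ g m ≡ -ℤ ∑ p g
∑-neg []      g = refl
∑-neg (m ∷ p) g = trans (cong (-ℤ g m +ℤ_) (∑-neg p g)) (sym (ℤP.neg-distrib-+ (g m) (∑ p g)))

∑-*ˡ : ∀ k p g → ∑[ m ∈ p ] (k *ℤ g m) ≡ k *ℤ ∑ p g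
∑-*ˡ k []      g = sym (ℤP.*-zeroʳ k)
∑-*ˡ k (m ∷ p) g = trans (cong (k *ℤ g m +ℤ_) (∑-*ˡ k p g)) (sym (ℤP.*-distribˡ-+ k (g m) (∑ p g)))

∑-comm : ∀ p q (G : Mono → Mono → ℤ) → ∑[ m ∈ p ] ∑[ m' ∈ q ] G m m' ≡ ∑[ m' ∈ q ] ∑[ m ∈ p ] G m m'
∑-comm []      q G = sym (∑-0 q)
∑-comm (m ∷ p) q G = trans (cong (∑ q (G m) +ℤ_) (∑-comm p q G)) (sym (∑-+ q (G m) _))

coeff-++ : ∀ p q i j → coeff (p ++ q) i j ≡ coeff p i j +ℤ coeff q i j
coeff-++ p q i j rewrite coeff≡∑ (p ++ q) i j | coeff≡∑ p i j | coeff≡∑ q i j = ∑-++ p q _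

coeff-neg : ∀ p i j → coeff (-P p) i j ≡ -ℤ coeff p i j
coeff-neg p i j rewrite coeff≡∑ (-P p) i j | coeff≡∑ p i j =
  trans (∑-map _ p _) (trans (∑-cong p λ { (c , a , b) → negate-coefficient a b c }) (∑-neg p _))
  where
  negate-coefficient : ∀ a b c → monomialCoeff (-ℤ c , a , b) i j ≡ -ℤ monomialCoeff (c , a , b) i j
  negate-coefficient a b c =
    trans (cong (δ a i *ℤ_) (sym (ℤP.neg-distribʳ-* (δ b j) c))) (sym (ℤP.neg-distribʳ-* (δ a i) _))

coeff-*P : ∀ p q i j → coeff (p *P q) i j ≡ ∑[ m ∈ p ] ∑[ m' ∈ q ] monomialCoeff (mulMono m m') i j
coeff-*P p q i j =
  trans (coeff≡∑ (p *P q) i j) (trans (∑-concatMap _ p _) (∑-cong p λ m → ∑-map (mulMono m) q _))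

coeff-monomial-*P : ∀ c a b q i j →
  ∑[ m ∈ q ] monomialCoeff (mulMono (c , a , b) m) i j ≡ (step a i *ℤ (step b j *ℤ c)) *ℤ coeff q (i ∸ a) (j ∸ b)
coeff-monomial-*P c a b q i j =
  trans (∑-cong q λ { (d , a' , b') → shift d a' b' })
        (trans (∑-*ˡ (step a i *ℤ (step b j *ℤ c)) q _) (cong (step a i *ℤ (step b j *ℤ c) *ℤ_) (sym (coeff≡∑ q _ _))))
  where
  open +-*-Solver
  shift : ∀ d a' b' → monomialCoeff (c *ℤ d , a ℕ.+ a' , b ℕ.+ b') i j
                      ≡ (step a i *ℤ (step b j *ℤ c)) *ℤ monomialCoeff (d , a' , b') (i ∸ a) (j ∸ b)
  shift d a' b' rewrite δ-+ a a' i | δ-+ b b' j =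
    solve 6 (λ s δa t δb c d → (s :* δa) :* ((t :* δb) :* (c :* d)) := (s :* (t :* c)) :* (δa :* (δb :* d))) refl
      (step a i) (δ a' (i ∸ a)) (step b j) (δ b' (j ∸ b)) c d

-- _≈P_ unfolds to a Π-type, which Agda cannot invert when solving for implicit arguments; this record can be.
infix 4 _≃_

record _≃_ (p q : Poly) : Set where
  constructor coeffwise
  field coeff≡ : p ≈P q

open _≃_

≃-isEquivalence : IsEquivalence _≃_
≃-isEquivalence = record
  { refl  = coeffwise λ i j → refl
  ; sym   = λ (coeffwise p≈q) → coeffwise λ i j → sym (p≈q i j)
  ; trans = λ (coeffwise p≈q) (coeffwise q≈r) → coeffwise λ i j → trans (p≈q i j) (q≈r i j)
  }

≃-setoid : Setoid 0ℓ 0ℓ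
≃-setoid = record { isEquivalence = ≃-isEquivalence }

+P-cong : ∀ {p p' q q'} → p ≃ p' → q ≃ q' → p +P q ≃ p' +P q'
+P-cong {p} {p'} {q} {q'} (coeffwise p≈p') (coeffwise q≈q') = coeffwise λ i j →
  trans (coeff-++ p q i j) (trans (cong₂ _+ℤ_ (p≈p' i j) (q≈q' i j)) (sym (coeff-++ p' q' i j)))

+P-assoc : ∀ p q r → (p +P q) +P r ≃ p +P (q +P r)
+P-assoc p q r = coeffwise λ i j → cong (λ s → coeff s i j) (List.++-assoc p q r)

+P-comm : ∀ p q → p +P q ≃ q +P p
+P-comm p q = coeffwise λ i j →
  trans (coeff-++ p q i j) (trans (ℤP.+-comm (coeff p i j) (coeff q i j)) (sym (coeff-++ q p i j)))

+P-identityˡ : ∀ p → 0P +P p ≃ p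
+P-identityˡ p = coeffwise λ i j → refl

-P-cong : ∀ {p q} → p ≃ q → -P p ≃ -P q
-P-cong {p} {q} (coeffwise p≈q) = coeffwise λ i j →
  trans (coeff-neg p i j) (trans (cong -ℤ_ (p≈q i j)) (sym (coeff-neg q i j)))

-P-inverseˡ : ∀ p → (-P p) +P p ≃ 0P
-P-inverseˡ p = coeffwise λ i j →
  trans (coeff-++ (-P p) p i j) (trans (cong (_+ℤ coeff p i j) (coeff-neg p i j)) (ℤP.+-inverseˡ (coeff p i j)))

*P-comm : ∀ p q → p *P q ≃ q *P p
*P-comm p q = coeffwise λ i j → begin
  coeff (p *P q) i j                                        ≡⟨ coeff-*P p q i j ⟩
  ∑[ m ∈ p ] ∑[ m' ∈ q ] monomialCoeff (mulMono m m') i j   ≡⟨ ∑-comm p q _ ⟩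
  ∑[ m' ∈ q ] ∑[ m ∈ p ] monomialCoeff (mulMono m m') i j
    ≡⟨ ∑-cong q (λ m' → ∑-cong p λ m → cong (λ n → monomialCoeff n i j) (mulMono-comm m m')) ⟩
  ∑[ m' ∈ q ] ∑[ m ∈ p ] monomialCoeff (mulMono m' m) i j   ≡⟨ coeff-*P q p i j ⟨
  coeff (q *P p) i j                                        ∎
  where
  open ≡-Reasoning
  mulMono-comm : ∀ m m' → mulMono m m' ≡ mulMono m' m
  mulMono-comm (c , a , b) (d , a' , b') rewrite ℤP.*-comm c d | ℕP.+-comm a a' | ℕP.+-comm b b' = refl

*P-congˡ : ∀ p {q q'} → q ≃ q' → p *P q ≃ p *P q'
*P-congˡ p {q} {q'} (coeffwise q≈q') = coeffwise λ i j →
  trans (coeff-*P p q i j) (trans (∑-cong p λ { (c , a , b) →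
    trans (coeff-monomial-*P c a b q i j)
          (trans (cong (step a i *ℤ (step b j *ℤ c) *ℤ_) (q≈q' _ _)) (sym (coeff-monomial-*P c a b q' i j))) })
  (sym (coeff-*P p q' i j)))

*P-cong : ∀ {p p' q q'} → p ≃ p' → q ≃ q' → p *P q ≃ p' *P q'
*P-cong {p} {p'} {q} {q'} p≃p' q≃q' = begin
  p *P q   ≈⟨ *P-congˡ p q≃q' ⟩
  p *P q'  ≈⟨ *P-comm p q' ⟩
  q' *P p  ≈⟨ *P-congˡ q' p≃p' ⟩
  q' *P p' ≈⟨ *P-comm q' p' ⟩
  p' *P q' ∎
  where open SetoidReasoning ≃-setoid

*P-assoc : ∀ p q r → (p *P q) *P r ≃ p *P (q *P r)
*P-assoc p q r = coeffwise λ i j →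
  trans (coeff-*P (p *P q) r i j) (trans (∑-concatMap _ p _) (trans (∑-cong p λ m →
    trans (∑-map (mulMono m) q _) (sym (trans (∑-concatMap _ q _) (∑-cong q λ m' →
      trans (∑-map (mulMono m') r _) (∑-cong r λ m'' → cong (λ n → monomialCoeff n i j) (sym (mulMono-assoc m m' m'')))))))
  (sym (coeff-*P p (q *P r) i j))))
  where
  mulMono-assoc : ∀ m m' m'' → mulMono (mulMono m m') m'' ≡ mulMono m (mulMono m' m'')
  mulMono-assoc (c , a , b) (d , a' , b') (e , a'' , b'')
    rewrite ℤP.*-assoc c d e | ℕP.+-assoc a a' a'' | ℕP.+-assoc b b' b'' = refl

*P-identityˡ : ∀ p → 1P *P p ≃ p
*P-identityˡ p = coeffwise λ i j →
  trans (coeff-*P 1P p i j) (trans (ℤP.+-identityʳ _) (trans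
    (∑-cong p λ { (c , a , b) → cong (λ c' → monomialCoeff (c' , a , b) i j) (ℤP.*-identityˡ c) })
    (sym (coeff≡∑ p i j))))

*P-distribˡ-+P : ∀ p q r → p *P (q +P r) ≃ p *P q +P p *P r
*P-distribˡ-+P p q r = coeffwise λ i j →
  trans (coeff-*P p (q +P r) i j) (trans (∑-cong p (λ m → ∑-++ q r _)) (trans (∑-+ p _ _)
    (sym (trans (coeff-++ (p *P q) (p *P r) i j) (cong₂ _+ℤ_ (coeff-*P p q i j) (coeff-*P p r i j))))))

Poly-commutativeRing : CommutativeRing 0ℓ 0ℓ
Poly-commutativeRing = record
  { Carrier = Poly ; _≈_ = _≃_ ; _+_ = _+P_ ; _*_ = _*P_ ; -_ = -P_ ; 0# = 0P ; 1# = 1P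
  ; isCommutativeRing = record
    { isRing = record
      { +-isAbelianGroup = record
        { isGroup = record
          { isMonoid = record
            { isSemigroup = record
              { isMagma = record { isEquivalence = ≃-isEquivalence ; ∙-cong = +P-cong }
              ; assoc = +P-assoc }
            ; identity = comm∧idˡ⇒id ≃-setoid +P-comm +P-identityˡ }
          ; inverse = comm∧invˡ⇒inv ≃-setoid +P-comm -P-inverseˡ
          ; ⁻¹-cong = -P-cong }
        ; comm = +P-comm }
      ; *-cong = *P-cong
      ; *-assoc = *P-assoc
      ; *-identity = comm∧idˡ⇒id ≃-setoid *P-comm *P-identityˡ
      ; distrib = *P-distribˡ-+P , comm∧distrˡ⇒distrʳ ≃-setoid +P-cong *P-comm *P-distribˡ-+P }
    ; *-comm = *P-comm } }

open CommutativeRing Poly-commutativeRing using (+-cong; *-cong; -‿cong; *-identityˡ; *-identityʳ)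
  renaming (refl to ≃-refl; sym to ≃-sym; trans to ≃-trans)
open RingProperties (CommutativeRing.ring Poly-commutativeRing) using (-1*x≈-x)

^P-+ : ∀ p m n → p ^P (m ℕ.+ n) ≃ p ^P m *P p ^P n
^P-+ p zero    n = ≃-sym (*P-identityˡ (p ^P n))
^P-+ p (suc m) n = ≃-trans (*-cong (≃-refl {p}) (^P-+ p m n)) (≃-sym (*P-assoc p (p ^P m) (p ^P n)))

coeff-constP : ∀ c i j → coeff (constP c) i j ≡ monomialCoeff (c , 0 , 0) i j
coeff-constP c i j = trans (coeff-∷ (c , 0 , 0) [] i j) (ℤP.+-identityʳ _)

constP-homomorphism : +-*-rawRing -Raw-AlmostCommutative⟶ fromCommutativeRing Poly-commutativeRing
constP-homomorphism = record
  { ⟦_⟧    = constP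
  ; +-homo = λ c c' → coeffwise λ i j →
      trans (coeff-constP (c +ℤ c') i j) (trans (monomialCoeff-+ c c' i j)
        (sym (trans (coeff-++ (constP c) (constP c') i j) (cong₂ _+ℤ_ (coeff-constP c i j) (coeff-constP c' i j)))))
  ; *-homo = λ _ _ → coeffwise λ _ _ → refl
  ; -‿homo = λ _ → coeffwise λ _ _ → refl
  ; 0-homo = coeffwise λ i j →
      trans (coeff-constP 0ℤ i j) (trans (cong (δ 0 i *ℤ_) (ℤP.*-zeroʳ (δ 0 j))) (ℤP.*-zeroʳ (δ 0 i)))
  ; 1-homo = coeffwise λ _ _ → refl
  }
  where
  monomialCoeff-+ : ∀ c c' i j →
    monomialCoeff (c +ℤ c' , 0 , 0) i j ≡ monomialCoeff (c , 0 , 0) i j +ℤ monomialCoeff (c' , 0 , 0) i j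
  monomialCoeff-+ c c' i j =
    trans (cong (δ 0 i *ℤ_) (ℤP.*-distribˡ-+ (δ 0 j) c c')) (ℤP.*-distribˡ-+ (δ 0 i) _ _)

_≟ᶜ_ : ∀ c c' → Maybe (constP c ≃ constP c')
c ≟ᶜ c' with c ≟ℤ c'
... | yes refl = just (coeffwise λ _ _ → refl)
... | no _     = nothing

module PolySolver = Algebra.Solver.Ring +-*-rawRing (fromCommutativeRing Poly-commutativeRing) constP-homomorphism _≟ᶜ_
open PolySolver using (Polynomial; con; var; _:+_; _:*_; :-_; _:-_; _:^_; _:=_; solve; ⟦_⟧)

h₁ᴱ : ∀ {n} → Polynomial n → Polynomial n → Polynomial n
h₁ᴱ t u = t :* t :- con (+ 2) :* (u :* con (+ 1))

Expr-rawRing : ℕ → RawRing 0ℓ 0ℓ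
Expr-rawRing n = record
  { Carrier = Polynomial n ; _≈_ = _≡_ ; _+_ = _:+_ ; _*_ = _:*_ ; -_ = :-_ ; 0# = con (+ 0) ; 1# = con (+ 1) }

module Expr {n} (t u : Polynomial n) = QuadraticExtension (Expr-rawRing n) t u (h₁ᴱ t u)

-- The operations of C on solver expressions: ⟦ numᴱ (Fᴱ t u (n /ᴱ d)) ⟧ is definitionally num (F (n / d)).
infix 5 _/ᴱ_

record Cᴱ (n : ℕ) : Set where
  constructor _/ᴱ_
  field numᴱ denᴱ : Polynomial n

open Cᴱ

module _ {n : ℕ} where

  infixl 6 _+ᴱ_ _-ᴱ_
  infixl 7 _*ᴱ_

  negᴱ : Cᴱ n → Cᴱ n
  negᴱ x = :- numᴱ x /ᴱ denᴱ x

  _+ᴱ_ _-ᴱ_ _*ᴱ_ : Cᴱ n → Cᴱ n → Cᴱ n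
  x +ᴱ y = numᴱ x :* denᴱ y :+ numᴱ y :* denᴱ x /ᴱ denᴱ x :* denᴱ y
  x -ᴱ y = x +ᴱ negᴱ y
  x *ᴱ y = numᴱ x :* numᴱ y /ᴱ denᴱ x :* denᴱ y

  invᴱ : Cᴱ n → Cᴱ n
  invᴱ x = denᴱ x /ᴱ numᴱ x

  ιᴱ : Polynomial n → Cᴱ n
  ιᴱ p = p /ᴱ con (+ 1)

  Fᴱ dfᴱ : Polynomial n → Polynomial n → Cᴱ n → Cᴱ n
  dfᴱ t u x = ιᴱ (con (+ 2)) *ᴱ x -ᴱ ιᴱ t
  Fᴱ  t u x = x -ᴱ (x *ᴱ x -ᴱ ιᴱ t *ᴱ x +ᴱ ιᴱ u) *ᴱ invᴱ (dfᴱ t u x)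

ev₁₀ᵐ : Mono → ℤ
ev₁₀ᵐ (c , a , b) = δ b 0 *ℤ c

ev₁₀ : Poly → ℤ
ev₁₀ p = ∑[ m ∈ p ] ev₁₀ᵐ m

ev₁₀-+P : ∀ p q → ev₁₀ (p +P q) ≡ ev₁₀ p +ℤ ev₁₀ q
ev₁₀-+P p q = ∑-++ p q _

ev₁₀--P : ∀ p → ev₁₀ (-P p) ≡ -ℤ ev₁₀ p
ev₁₀--P p = trans (∑-map _ p _) (trans (∑-cong p λ { (c , a , b) → sym (ℤP.neg-distribʳ-* (δ b 0) c) }) (∑-neg p _))

ev₁₀-*P : ∀ p q → ev₁₀ (p *P q) ≡ ev₁₀ p *ℤ ev₁₀ q
ev₁₀-*P p q =
  trans (∑-concatMap _ p _)
  (trans (∑-cong p λ m → trans (∑-map (mulMono m) q _) (trans (∑-cong q (ev₁₀ᵐ-mulMono m)) (∑-*ˡ (ev₁₀ᵐ m) q _)))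
  (trans (∑-cong p λ m → ℤP.*-comm (ev₁₀ᵐ m) (ev₁₀ q))
  (trans (∑-*ˡ (ev₁₀ q) p _) (ℤP.*-comm (ev₁₀ q) (ev₁₀ p)))))
  where
  δ-+0 : ∀ b b' → δ (b ℕ.+ b') 0 ≡ δ b 0 *ℤ δ b' 0
  δ-+0 zero    b' = sym (ℤP.*-identityˡ _)
  δ-+0 (suc b) b' = refl
  ev₁₀ᵐ-mulMono : ∀ m m' → ev₁₀ᵐ (mulMono m m') ≡ ev₁₀ᵐ m *ℤ ev₁₀ᵐ m'
  ev₁₀ᵐ-mulMono (c , a , b) (c' , a' , b') rewrite δ-+0 b b' =
    *-interchange (δ b 0) (δ b' 0) c c'

∑< : ℕ → (ℕ → ℤ) → ℤ
∑< zero    f = 0ℤ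
∑< (suc n) f = ∑< n f +ℤ f n

∑<-cong : ∀ n {f g} → (∀ i → f i ≡ g i) → ∑< n f ≡ ∑< n g
∑<-cong zero    f≗g = refl
∑<-cong (suc n) f≗g = cong₂ _+ℤ_ (∑<-cong n f≗g) (f≗g n)

∑<-0 : ∀ n → ∑< n (λ _ → 0ℤ) ≡ 0ℤ
∑<-0 zero    = refl
∑<-0 (suc n) = trans (ℤP.+-identityʳ _) (∑<-0 n)

∑<-+ : ∀ n f g → ∑< n (λ i → f i +ℤ g i) ≡ ∑< n f +ℤ ∑< n g
∑<-+ zero    f g = refl
∑<-+ (suc n) f g = trans (cong (_+ℤ (f n +ℤ g n)) (∑<-+ n f g)) (interchange (∑< n f) (∑< n g) (f n) (g n))

∑<-*ʳ : ∀ n f k → ∑< n (λ i → f i *ℤ k) ≡ ∑< n f *ℤ k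
∑<-*ʳ zero    f k = sym (ℤP.*-zeroˡ k)
∑<-*ʳ (suc n) f k = trans (cong (_+ℤ f n *ℤ k) (∑<-*ʳ n f k)) (sym (ℤP.*-distribʳ-+ k (∑< n f) (f n)))

∑<-δ-≥ : ∀ a n → n ℕ.≤ a → ∑< n (δ a) ≡ 0ℤ
∑<-δ-≥ a zero    _   = refl
∑<-δ-≥ a (suc n) n<a rewrite ∑<-δ-≥ a n (ℕP.<⇒≤ n<a) | δ-≢ (ℕP.<⇒≢ n<a ∘ sym) = refl

∑<-δ-< : ∀ a n → a ℕ.< n → ∑< n (δ a) ≡ 1ℤ
∑<-δ-< a (suc n) a<1+n with a ℕ.≟ n
... | yes refl rewrite ∑<-δ-≥ a a ℕP.≤-refl | δ-refl a = refl
... | no a≢n   rewrite ∑<-δ-< a n (ℕP.≤∧≢⇒< (ℕP.≤-pred a<1+n) a≢n) | δ-≢ a≢n = refl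

degT : Poly → ℕ
degT []              = 0
degT ((_ , a , _) ∷ p) = a ℕ.⊔ degT p

ev₁₀≡∑<coeff : ∀ p n → degT p ℕ.< n → ev₁₀ p ≡ ∑< n (λ i → coeff p i 0)
ev₁₀≡∑<coeff []              n _       = sym (∑<-0 n)
ev₁₀≡∑<coeff ((c , a , b) ∷ p) n deg<n = begin
  ev₁₀ᵐ (c , a , b) +ℤ ev₁₀ p
    ≡⟨ cong₂ _+ℤ_ (sym monomial) (ev₁₀≡∑<coeff p n (ℕP.≤-trans (ℕ.s≤s (ℕP.m≤n⊔m a (degT p))) deg<n)) ⟩
  ∑< n (λ i → δ a i *ℤ ev₁₀ᵐ (c , a , b)) +ℤ ∑< n (λ i → coeff p i 0)
    ≡⟨ sym (∑<-+ n _ _) ⟩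
  ∑< n (λ i → monomialCoeff (c , a , b) i 0 +ℤ coeff p i 0)
    ≡⟨ sym (∑<-cong n λ i → coeff-∷ (c , a , b) p i 0) ⟩
  ∑< n (λ i → coeff ((c , a , b) ∷ p) i 0) ∎
  where
  open ≡-Reasoning
  monomial : ∑< n (λ i → δ a i *ℤ ev₁₀ᵐ (c , a , b)) ≡ ev₁₀ᵐ (c , a , b)
  monomial = trans (∑<-*ʳ n (δ a) _)
    (trans (cong (_*ℤ ev₁₀ᵐ (c , a , b)) (∑<-δ-< a n (ℕP.≤-trans (ℕ.s≤s (ℕP.m≤m⊔n a (degT p))) deg<n)))
           (ℤP.*-identityˡ _))

IsZeroP⇒ev₁₀≡0 : ∀ p → IsZeroP p → ev₁₀ p ≡ 0ℤ
IsZeroP⇒ev₁₀≡0 p p≈0 =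
  trans (ev₁₀≡∑<coeff p (suc (degT p)) ℕP.≤-refl) (trans (∑<-cong (suc (degT p)) λ i → p≈0 i 0) (∑<-0 (suc (degT p))))

ev₁₀≢0⇒Nonzero : ∀ x → ev₁₀ (num x) ≢ 0ℤ → Nonzero x
ev₁₀≢0⇒Nonzero x ev≢0 num≈0 = ev≢0 (IsZeroP⇒ev₁₀≡0 (num x) num≈0)

ev₁₀-⟦⟧ : ∀ {k} (e : Polynomial k) {ρ ρ' : Vec Poly k} →
          VecPointwise (λ p p' → ev₁₀ p ≡ ev₁₀ p') ρ ρ' → ev₁₀ (⟦ e ⟧ ρ) ≡ ev₁₀ (⟦ e ⟧ ρ')
ev₁₀-⟦⟧ (PolySolver.op PolySolver.[+] e₁ e₂) {ρ} {ρ'} ρ≡ρ' =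
  trans (ev₁₀-+P (⟦ e₁ ⟧ ρ) (⟦ e₂ ⟧ ρ))
    (trans (cong₂ _+ℤ_ (ev₁₀-⟦⟧ e₁ ρ≡ρ') (ev₁₀-⟦⟧ e₂ ρ≡ρ')) (sym (ev₁₀-+P (⟦ e₁ ⟧ ρ') (⟦ e₂ ⟧ ρ'))))
ev₁₀-⟦⟧ (PolySolver.op PolySolver.[*] e₁ e₂) {ρ} {ρ'} ρ≡ρ' =
  trans (ev₁₀-*P (⟦ e₁ ⟧ ρ) (⟦ e₂ ⟧ ρ))
    (trans (cong₂ _*ℤ_ (ev₁₀-⟦⟧ e₁ ρ≡ρ') (ev₁₀-⟦⟧ e₂ ρ≡ρ')) (sym (ev₁₀-*P (⟦ e₁ ⟧ ρ') (⟦ e₂ ⟧ ρ'))))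
ev₁₀-⟦⟧ (con c)  ρ≡ρ' = refl
ev₁₀-⟦⟧ (var x)  ρ≡ρ' = VecPointwise.lookup ρ≡ρ' x
ev₁₀-⟦⟧ (e :^ k) {ρ} {ρ'} ρ≡ρ' = power k
  where
  power : ∀ k → ev₁₀ (⟦ e :^ k ⟧ ρ) ≡ ev₁₀ (⟦ e :^ k ⟧ ρ')
  power zero    = refl
  power (suc k) = trans (ev₁₀-*P (⟦ e ⟧ ρ) (⟦ e :^ k ⟧ ρ))
    (trans (cong₂ _*ℤ_ (ev₁₀-⟦⟧ e ρ≡ρ') (power k)) (sym (ev₁₀-*P (⟦ e ⟧ ρ') (⟦ e :^ k ⟧ ρ'))))
ev₁₀-⟦⟧ (:- e) {ρ} {ρ'} ρ≡ρ' =
  trans (ev₁₀--P (⟦ e ⟧ ρ)) (trans (cong -ℤ_ (ev₁₀-⟦⟧ e ρ≡ρ')) (sym (ev₁₀--P (⟦ e ⟧ ρ'))))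

-- Powers of η

-- 0# is constP (+ 0) rather than 0P = [], so that it is what the solver constant con (+ 0) denotes.
Poly-rawRing : RawRing 0ℓ 0ℓ
Poly-rawRing = record
  { Carrier = Poly ; _≈_ = _≃_ ; _+_ = _+P_ ; _*_ = _*P_ ; -_ = -P_ ; 0# = constP (+ 0) ; 1# = 1P }

open QuadraticExtension Poly-rawRing TP UP (h 1)

infix 4 _≈²_
_≈²_ : Poly × Poly → Poly × Poly → Set
_≈²_ = Pointwise _≃_ _≃_

open Setoid (×-setoid ≃-setoid ≃-setoid) using ()
  renaming (refl to ≈²-refl; sym to ≈²-sym; trans to ≈²-trans)

⊗-cong : ∀ {z z' w w'} → z ≈² z' → w ≈² w' → z ⊗ w ≈² z' ⊗ w'
⊗-cong (c≃ , d≃) (c'≃ , d'≃) =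
    +-cong (*-cong c≃ c'≃) (-‿cong (*-cong (*-cong d≃ d'≃) (≃-refl {UP *P UP})))
  , +-cong (+-cong (*-cong c≃ d'≃) (*-cong d≃ c'≃)) (*-cong (*-cong d≃ d'≃) (≃-refl {h 1}))

⊗-assoc : ∀ z w v → (z ⊗ w) ⊗ v ≈² z ⊗ (w ⊗ v)
⊗-assoc (c , d) (c' , d') (c'' , d'') =
    solve 8 (λ c d c' d' c'' d'' t u → let module E = Expr t u in
      proj₁ (((c , d) E.⊗ (c' , d')) E.⊗ (c'' , d'')) := proj₁ ((c , d) E.⊗ ((c' , d') E.⊗ (c'' , d''))))
      ≃-refl c d c' d' c'' d'' TP UP
  , solve 8 (λ c d c' d' c'' d'' t u → let module E = Expr t u in
      proj₂ (((c , d) E.⊗ (c' , d')) E.⊗ (c'' , d'')) := proj₂ ((c , d) E.⊗ ((c' , d') E.⊗ (c'' , d''))))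
      ≃-refl c d c' d' c'' d'' TP UP

⊗-identityˡ : ∀ z → η^ 0 ⊗ z ≈² z
⊗-identityˡ (c , d) =
    solve 4 (λ c d t u → let module E = Expr t u in proj₁ (E.η^ 0 E.⊗ (c , d)) := c) ≃-refl c d TP UP
  , solve 4 (λ c d t u → let module E = Expr t u in proj₂ (E.η^ 0 E.⊗ (c , d)) := d) ≃-refl c d TP UP

η^-+ : ∀ k l → η^ (k ℕ.+ l) ≈² η^ k ⊗ η^ l
η^-+ zero    l = ≈²-sym (⊗-identityˡ (η^ l))
η^-+ (suc k) l = ≈²-trans (⊗-cong (≈²-refl {η}) (η^-+ k l)) (≈²-sym (⊗-assoc η (η^ k) (η^ l)))

η^2^ : ℕ → Poly × Poly
η^2^ n = η^ (2 ^ n)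

η^2^-suc : ∀ n → η^2^ (suc n) ≈² η^2^ n ⊗ η^2^ n
η^2^-suc n = subst (λ k → η^2^ (suc n) ≈² η^2^ n ⊗ η^ k) (ℕP.+-identityʳ (2 ^ n)) (η^-+ (2 ^ n) (2 ^ n ℕ.+ 0))

trace-cong : ∀ {z z'} → z ≈² z' → trace z ≃ trace z'
trace-cong (c≃ , d≃) = +-cong (*-cong (≃-refl {1P +P 1P}) c≃) (*-cong d≃ (≃-refl {h 1}))

norm-cong : ∀ {z z'} → z ≈² z' → norm z ≃ norm z'
norm-cong (c≃ , d≃) =
  +-cong (+-cong (*-cong c≃ c≃) (*-cong (*-cong c≃ d≃) (≃-refl {h 1}))) (*-cong (*-cong d≃ d≃) (≃-refl {UP *P UP}))

numer-cong : ∀ {z z'} → z ≈² z' → numer z ≃ numer z'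
numer-cong (c≃ , d≃) = +-cong (*-cong d≃ (≃-refl {UP})) (-‿cong c≃)

denom-cong : ∀ {z z'} → z ≈² z' → denom z ≃ denom z'
denom-cong (c≃ , d≃) = *-cong d≃ (≃-refl {TP})

trace-square : ∀ z → trace (z ⊗ z) ≃ trace z *P trace z -P constP (+ 2) *P norm z
trace-square (c , d) = solve 4 (λ c d t u → let module E = Expr t u in
  E.trace ((c , d) E.⊗ (c , d)) := E.trace (c , d) :* E.trace (c , d) :- con (+ 2) :* E.norm (c , d)) ≃-refl c d TP UP

norm-square : ∀ z → norm (z ⊗ z) ≃ norm z *P norm z
norm-square (c , d) = solve 4 (λ c d t u → let module E = Expr t u in
  E.norm ((c , d) E.⊗ (c , d)) := E.norm (c , d) :* E.norm (c , d)) ≃-refl c d TP UP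

denom-square : ∀ z → denom (z ⊗ z) ≃ denom z *P trace z
denom-square (c , d) = solve 4 (λ c d t u → let module E = Expr t u in
  E.denom ((c , d) E.⊗ (c , d)) := E.denom (c , d) :* E.trace (c , d)) ≃-refl c d TP UP

numer-square : ∀ z → numer (z ⊗ z) ≃ numer z *P trace z +P norm z
numer-square (c , d) = solve 4 (λ c d t u → let module E = Expr t u in
  E.numer ((c , d) E.⊗ (c , d)) := E.numer (c , d) :* E.trace (c , d) :+ E.norm (c , d)) ≃-refl c d TP UP

norm-η^2^ : ∀ n → norm (η^2^ n) ≃ UP ^P (2 ^ suc n)
norm-η^2^ zero    = solve 2 (λ t u → let module E = Expr t u in E.norm (E.η^ 1) := u :* (u :* con (+ 1))) ≃-refl TP UP
norm-η^2^ (suc n) = begin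
  norm (η^2^ (suc n))                        ≈⟨ norm-cong (η^2^-suc n) ⟩
  norm (η^2^ n ⊗ η^2^ n)                        ≈⟨ norm-square (η^2^ n) ⟩
  norm (η^2^ n) *P norm (η^2^ n)                ≈⟨ *-cong (norm-η^2^ n) (norm-η^2^ n) ⟩
  UP ^P (2 ^ suc n) *P UP ^P (2 ^ suc n)  ≈⟨ ≃-sym (^P-+ UP (2 ^ suc n) (2 ^ suc n)) ⟩
  UP ^P (2 ^ suc n ℕ.+ 2 ^ suc n)         ≡⟨ cong (λ k → UP ^P (2 ^ suc n ℕ.+ k)) (ℕP.+-identityʳ (2 ^ suc n)) ⟨
  UP ^P (2 ^ suc (suc n))                 ∎
  where open SetoidReasoning ≃-setoid

trace-η^2^ : ∀ n → trace (η^2^ n) ≃ h (suc n)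
trace-η^2^ zero    = solve 2 (λ t u → let module E = Expr t u in E.trace (E.η^ 1) := h₁ᴱ t u) ≃-refl TP UP
trace-η^2^ (suc n) = begin
  trace (η^2^ (suc n))                                           ≈⟨ trace-cong (η^2^-suc n) ⟩
  trace (η^2^ n ⊗ η^2^ n)                                           ≈⟨ trace-square (η^2^ n) ⟩
  trace (η^2^ n) *P trace (η^2^ n) -P constP (+ 2) *P norm (η^2^ n)
    ≈⟨ +-cong (*-cong (trace-η^2^ n) (trace-η^2^ n)) (-‿cong (*-cong (≃-refl {constP (+ 2)}) (norm-η^2^ n))) ⟩
  h (suc (suc n))                                             ∎
  where open SetoidReasoning ≃-setoid

prodH≃denom-η^2^ : ∀ n → prodH n ≃ denom (η^2^ n)
prodH≃denom-η^2^ zero    = solve 2 (λ t u → let module E = Expr t u in t := E.denom (E.η^ 1)) ≃-refl TP UP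
prodH≃denom-η^2^ (suc n) = begin
  prodH n *P h (suc n)           ≈⟨ *-cong (prodH≃denom-η^2^ n) (≃-sym (trace-η^2^ n)) ⟩
  denom (η^2^ n) *P trace (η^2^ n)     ≈⟨ denom-square (η^2^ n) ⟨
  denom (η^2^ n ⊗ η^2^ n)              ≈⟨ denom-cong (η^2^-suc n) ⟨
  denom (η^2^ (suc n))              ∎
  where open SetoidReasoning ≃-setoid

-- C's _≈_ is transitive only over an integral domain, which ℤ[T,U] is not shown to be here; so an element
-- of C is described by a numerator and a denominator up to a common factor instead.
infix 4 _≐_÷_ _≋_÷_

record _≐_÷_ (x : C) (p q : Poly) : Set where
  constructor scaled
  field
    factor : Poly
    num≃   : num x ≃ factor *P p
    den≃   : den x ≃ factor *P q

record _≋_÷_ (y : C) (p q : Poly) : Set where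
  constructor cross
  field cross-multiplied : num y *P q ≃ p *P den y

≐-self : ∀ x → x ≐ num x ÷ den x
≐-self x = scaled 1P (≃-sym (*P-identityˡ (num x))) (≃-sym (*P-identityˡ (den x)))

≐-resp : ∀ {x p p' q q'} → p ≃ p' → q ≃ q' → x ≐ p ÷ q → x ≐ p' ÷ q'
≐-resp p≃p' q≃q' (scaled g num≃ den≃) =
  scaled g (≃-trans num≃ (*-cong (≃-refl {g}) p≃p')) (≃-trans den≃ (*-cong (≃-refl {g}) q≃q'))

≐-cancel : ∀ {x k p q} → x ≐ k *P p ÷ k *P q → x ≐ p ÷ q
≐-cancel {k = k} {p} {q} (scaled g num≃ den≃) =
  scaled (g *P k) (≃-trans num≃ (≃-sym (*P-assoc g k p))) (≃-trans den≃ (≃-sym (*P-assoc g k q)))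

≐-negate : ∀ {x p q} → x ≐ -P p ÷ -P q → x ≐ p ÷ q
≐-negate {p = p} {q} x≐ = ≐-cancel {k = -P 1P} (≐-resp (≃-sym (-1*x≈-x p)) (≃-sym (-1*x≈-x q)) x≐)

+inv-≐ : ∀ {x y p q r s} → x ≐ p ÷ q → y ≐ r ÷ s → x + inv y ≐ p *P r +P s *P q ÷ q *P r
+inv-≐ {p = p} {q} {r} {s} (scaled g num≃ den≃) (scaled g' num'≃ den'≃) = scaled (g *P g')
  (≃-trans (+-cong (*-cong num≃ num'≃) (*-cong den'≃ den≃))
    (solve 6 (λ g g' p q r s → g :* p :* (g' :* r) :+ g' :* s :* (g :* q) := g :* g' :* (p :* r :+ s :* q))
      ≃-refl g g' p q r s))
  (≃-trans (*-cong den≃ num'≃) (solve 4 (λ g g' q r → g :* q :* (g' :* r) := g :* g' :* (q :* r)) ≃-refl g g' q r))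

≐∧≋⇒≈ : ∀ {x y p q} → x ≐ p ÷ q → y ≋ p ÷ q → x ≈ y
≐∧≋⇒≈ {x} {y} {p} {q} (scaled g num≃ den≃) (cross y≋) = coeff≡ (begin
  num x *P den y        ≈⟨ *-cong num≃ (≃-refl {den y}) ⟩
  g *P p *P den y       ≈⟨ *P-assoc g p (den y) ⟩
  g *P (p *P den y)     ≈⟨ *-cong (≃-refl {g}) y≋ ⟨
  g *P (num y *P q)     ≈⟨ solve 3 (λ g n q → g :* (n :* q) := n :* (g :* q)) ≃-refl g (num y) q ⟩
  num y *P (g *P q)     ≈⟨ *-cong (≃-refl {num y}) den≃ ⟨
  num y *P den x        ∎)
  where open SetoidReasoning ≃-setoid

T-minus-≋ : ∀ {y p q} → y ≋ p ÷ q → Tc - y ≋ TP *P q -P p ÷ q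
T-minus-≋ {y} {p} {q} (cross y≋) = cross (begin
  (TP *P den y +P (-P num y) *P 1P) *P q
    ≈⟨ solve 4 (λ t n d q → (t :* d :+ (:- n) :* con (+ 1)) :* q := t :* d :* q :- n :* q) ≃-refl TP (num y) (den y) q ⟩
  TP *P den y *P q -P num y *P q
    ≈⟨ +-cong (≃-refl {TP *P den y *P q}) (-‿cong y≋) ⟩
  TP *P den y *P q -P p *P den y
    ≈⟨ solve 4 (λ t p d q → t :* d :* q :- p :* d := (t :* q :- p) :* (con (+ 1) :* d)) ≃-refl TP p (den y) q ⟩
  (TP *P q -P p) *P (1P *P den y) ∎)
  where open SetoidReasoning ≃-setoid

S-≋ : ∀ n → S n ≋ numer (η^2^ n) ÷ denom (η^2^ n)
S-≋ zero    = cross (solve 2 (λ t u → let module E = Expr t u in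
  u :* con (+ 1) :* E.denom (E.η^ 1) := E.numer (E.η^ 1) :* t) ≃-refl TP UP)
S-≋ (suc n) = cross (begin
  (X *P Π +P V *P Y) *P denom (η^2^ (suc n))
    ≈⟨ *-cong (+-cong (*-cong (≃-refl {X}) Π≃) (*-cong (≃-sym (norm-η^2^ n)) (≃-refl {Y}))) denom-η^2^-suc ⟩
  (X *P (q *P t) +P N *P Y) *P (q *P t)
    ≈⟨ solve 5 (λ X q t N Y → (X :* (q :* t) :+ N :* Y) :* (q :* t) := X :* q :* (t :* (q :* t)) :+ N :* (Y :* (q :* t)))
         ≃-refl X q t N Y ⟩
  X *P q *P (t *P (q *P t)) +P N *P (Y *P (q *P t))
    ≈⟨ +-cong (*-cong (_≋_÷_.cross-multiplied (S-≋ n)) (≃-refl {t *P (q *P t)})) (≃-refl {N *P (Y *P (q *P t))}) ⟩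
  p *P Y *P (t *P (q *P t)) +P N *P (Y *P (q *P t))
    ≈⟨ solve 5 (λ p Y t q N → p :* Y :* (t :* (q :* t)) :+ N :* (Y :* (q :* t)) := (p :* t :+ N) :* (Y :* (q :* t)))
         ≃-refl p Y t q N ⟩
  (p *P t +P N) *P (Y *P (q *P t))
    ≈⟨ *-cong numer-η^2^-suc (*-cong (≃-refl {Y}) Π≃) ⟨
  numer (η^2^ (suc n)) *P (Y *P Π) ∎)
  where
  open SetoidReasoning ≃-setoid
  X Y Π V p q t N : Poly
  X = num (S n)
  Y = den (S n)
  Π = prodH (suc n)
  V = UP ^P (2 ^ suc n)
  p = numer (η^2^ n)
  q = denom (η^2^ n)
  t = trace (η^2^ n)
  N = norm (η^2^ n)
  denom-η^2^-suc : denom (η^2^ (suc n)) ≃ q *P t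
  denom-η^2^-suc = ≃-trans (denom-cong (η^2^-suc n)) (denom-square (η^2^ n))
  numer-η^2^-suc : numer (η^2^ (suc n)) ≃ p *P t +P N
  numer-η^2^-suc = ≃-trans (numer-cong (η^2^-suc n)) (numer-square (η^2^ n))
  Π≃ : Π ≃ q *P t
  Π≃ = ≃-trans (prodH≃denom-η^2^ (suc n)) denom-η^2^-suc

-- Newton iteration

-- Computed in C, F (n / d) is the Newton quotient (n² − U d²) / (d (2n − T d)) with both parts multiplied by d³.
num-F : ∀ x → num (F x) ≃ den x *P den x *P den x *P (num x *P num x -P UP *P (den x *P den x))
num-F x = solve 4 (λ n d t u → numᴱ (Fᴱ t u (n /ᴱ d)) := d :* d :* d :* (n :* n :- u :* (d :* d)))
  ≃-refl (num x) (den x) TP UP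

den-F : ∀ x → den (F x) ≃ den x *P den x *P den x *P den x *P (constP (+ 2) *P num x -P TP *P den x)
den-F x = solve 4 (λ n d t u → denᴱ (Fᴱ t u (n /ᴱ d)) := d :* d :* d :* d :* (con (+ 2) :* n :- t :* d))
  ≃-refl (num x) (den x) TP UP

F-≐ : ∀ {x p q} → x ≐ p ÷ q → F x ≐ p *P p -P UP *P (q *P q) ÷ q *P (constP (+ 2) *P p -P TP *P q)
F-≐ {x} {p} {q} (scaled g num≃ den≃) = scaled (g *P g *P g *P g *P g *P (q *P q *P q))
  (begin
    num (F x)
      ≈⟨ num-F x ⟩
    den x *P den x *P den x *P (num x *P num x -P UP *P (den x *P den x))
      ≈⟨ *-cong (*-cong (*-cong den≃ den≃) den≃)
                (+-cong (*-cong num≃ num≃) (-‿cong (*-cong (≃-refl {UP}) (*-cong den≃ den≃)))) ⟩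
    g *P q *P (g *P q) *P (g *P q) *P (g *P p *P (g *P p) -P UP *P (g *P q *P (g *P q)))
      ≈⟨ solve 4 (λ g p q u → g :* q :* (g :* q) :* (g :* q) :* (g :* p :* (g :* p) :- u :* (g :* q :* (g :* q)))
                            := g :* g :* g :* g :* g :* (q :* q :* q) :* (p :* p :- u :* (q :* q))) ≃-refl g p q UP ⟩
    g *P g *P g *P g *P g *P (q *P q *P q) *P (p *P p -P UP *P (q *P q)) ∎)
  (begin
    den (F x)
      ≈⟨ den-F x ⟩
    den x *P den x *P den x *P den x *P (constP (+ 2) *P num x -P TP *P den x)
      ≈⟨ *-cong (*-cong (*-cong (*-cong den≃ den≃) den≃) den≃)
                (+-cong (*-cong (≃-refl {constP (+ 2)}) num≃) (-‿cong (*-cong (≃-refl {TP}) den≃))) ⟩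
    g *P q *P (g *P q) *P (g *P q) *P (g *P q) *P (constP (+ 2) *P (g *P p) -P TP *P (g *P q))
      ≈⟨ solve 4 (λ g p q t → g :* q :* (g :* q) :* (g :* q) :* (g :* q) :* (con (+ 2) :* (g :* p) :- t :* (g :* q))
                            := g :* g :* g :* g :* g :* (q :* q :* q) :* (q :* (con (+ 2) :* p :- t :* q))) ≃-refl g p q TP ⟩
    g *P g *P g *P g *P g *P (q *P q *P q) *P (q *P (constP (+ 2) *P p -P TP *P q)) ∎)
  where open SetoidReasoning ≃-setoid

F-square : ∀ {x} z → x ≐ numer z ÷ denom z → F x ≐ numer (z ⊗ z) ÷ denom (z ⊗ z)
F-square (c , d) x≐ = ≐-negate (≐-resp
  (solve 4 (λ c d t u →
     let module E = Expr t u
         p = E.numer (c , d)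
         q = E.denom (c , d)
     in p :* p :- u :* (q :* q) := :- E.numer ((c , d) E.⊗ (c , d))) ≃-refl c d TP UP)
  (solve 4 (λ c d t u →
     let module E = Expr t u
         p = E.numer (c , d)
         q = E.denom (c , d)
     in q :* (con (+ 2) :* p :- t :* q) := :- E.denom ((c , d) E.⊗ (c , d))) ≃-refl c d TP UP)
  (F-≐ x≐))

F-square-T-minus : ∀ {x} z → x ≐ TP *P denom z -P numer z ÷ denom z
                 → F x ≐ TP *P denom (z ⊗ z) -P numer (z ⊗ z) ÷ denom (z ⊗ z)
F-square-T-minus (c , d) x≐ = ≐-resp
  (solve 4 (λ c d t u →
     let module E = Expr t u
         p = E.numer (c , d)
         q = E.denom (c , d)
     in (t :* q :- p) :* (t :* q :- p) :- u :* (q :* q)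
          := t :* E.denom ((c , d) E.⊗ (c , d)) :- E.numer ((c , d) E.⊗ (c , d))) ≃-refl c d TP UP)
  (solve 4 (λ c d t u →
     let module E = Expr t u
         p = E.numer (c , d)
         q = E.denom (c , d)
     in q :* (con (+ 2) :* (t :* q :- p) :- t :* q) := E.denom ((c , d) E.⊗ (c , d))) ≃-refl c d TP UP)
  (F-≐ x≐)

iterF-0-≐ : ∀ n → iterF (suc n) 0C ≐ numer (η^2^ n) ÷ denom (η^2^ n)
iterF-0-≐ zero = ≐-negate (≐-resp
  (solve 2 (λ t u → let module E = Expr t u in :- (u :* (con (+ 1) :* con (+ 1))) := :- E.numer (E.η^ 1)) ≃-refl TP UP)
  (solve 2 (λ t u → let module E = Expr t u in con (+ 1) :* (:- (t :* con (+ 1))) := :- E.denom (E.η^ 1)) ≃-refl TP UP)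
  (F-≐ (≐-self 0C)))
iterF-0-≐ (suc n) =
  ≐-resp (numer-cong (≈²-sym (η^2^-suc n))) (denom-cong (≈²-sym (η^2^-suc n))) (F-square (η^2^ n) (iterF-0-≐ n))

iterF-T-≐ : ∀ n → iterF (suc n) Tc ≐ TP *P denom (η^2^ n) -P numer (η^2^ n) ÷ denom (η^2^ n)
iterF-T-≐ zero = ≐-resp
  (solve 2 (λ t u → let module E = Expr t u in
     t :* t :- u :* (con (+ 1) :* con (+ 1)) := t :* E.denom (E.η^ 1) :- E.numer (E.η^ 1)) ≃-refl TP UP)
  (solve 2 (λ t u → let module E = Expr t u in con (+ 1) :* (con (+ 2) :* t :- t :* con (+ 1)) := E.denom (E.η^ 1)) ≃-refl TP UP)
  (F-≐ (≐-self Tc))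
iterF-T-≐ (suc n) = ≐-resp
  (+-cong (*-cong (≃-refl {TP}) (denom-cong (≈²-sym (η^2^-suc n)))) (-‿cong (numer-cong (≈²-sym (η^2^-suc n)))))
  (denom-cong (≈²-sym (η^2^-suc n)))
  (F-square-T-minus (η^2^ n) (iterF-T-≐ n))

-- Continued fractions

double : ℕ → ℕ
double zero    = zero
double (suc m) = suc (suc (double m))

cf-periodic₂ : ∀ {c α β} → (∀ i → c (suc (double i)) ≡ α) → (∀ i → c (suc (suc (double i))) ≡ β) →
               ∀ i m → cf c (suc (double i)) (double (suc m)) ≡ α + inv (β + inv (cf c (suc (double (suc i))) (double m)))
cf-periodic₂ {c} odd even i m = cong₂ (λ α β → α + inv (β + inv (cf c (suc (double (suc i))) (double m)))) (odd i) (even i)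

a-odd : ∀ i → a (suc (double i)) ≡ a 1
a-odd zero    = refl
a-odd (suc i) = a-odd i

a-even : ∀ i → a (suc (suc (double i))) ≡ a 2
a-even zero    = refl
a-even (suc i) = a-even i

b-odd : ∀ i → b (suc (double i)) ≡ b 1
b-odd zero    = refl
b-odd (suc i) = b-odd i

b-even : ∀ i → b (suc (suc (double i))) ≡ b 2
b-even zero    = refl
b-even (suc i) = b-even i

a-tail-≐ : ∀ m i → cf a (suc (double i)) (double m) ≐ denom (η^ (suc m)) ÷ numer (η^ (suc m))
a-tail-≐ zero    i = subst (_≐ _ ÷ _) (sym (a-odd i)) (≐-resp
  (solve 2 (λ t u → let module E = Expr t u in t :* con (+ 1) := E.denom (E.η^ 1)) ≃-refl TP UP)
  (solve 2 (λ t u → let module E = Expr t u in con (+ 1) :* u := E.numer (E.η^ 1)) ≃-refl TP UP)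
  (≐-self (a 1)))
a-tail-≐ (suc m) i = subst (_≐ _ ÷ _) (sym (cf-periodic₂ a-odd a-even i m)) (≐-negate (≐-resp
  (solve 4 (λ c d t u → let module E = Expr t u in
     numᴱ (ιᴱ t *ᴱ invᴱ (ιᴱ u) +ᴱ invᴱ (negᴱ (ιᴱ t) +ᴱ invᴱ (E.denom (c , d) /ᴱ E.numer (c , d))))
       := :- E.denom (E.η E.⊗ (c , d)))
     ≃-refl (proj₁ z) (proj₂ z) TP UP)
  (solve 4 (λ c d t u → let module E = Expr t u in
     denᴱ (ιᴱ t *ᴱ invᴱ (ιᴱ u) +ᴱ invᴱ (negᴱ (ιᴱ t) +ᴱ invᴱ (E.denom (c , d) /ᴱ E.numer (c , d))))
       := :- E.numer (E.η E.⊗ (c , d)))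
     ≃-refl (proj₁ z) (proj₂ z) TP UP)
  (+inv-≐ (≐-self (a 1)) (+inv-≐ (≐-self (a 2)) (a-tail-≐ m (suc i))))))
  where
  z : Poly × Poly
  z = η^ (suc m)

b-tail-≐ : ∀ m i → cf b (suc (double i)) (double m) ≐ -P denom (η^ (suc m)) ÷ numer (η^ (suc m))
b-tail-≐ zero    i = subst (_≐ _ ÷ _) (sym (b-odd i)) (≐-resp
  (solve 2 (λ t u → let module E = Expr t u in :- (t :* con (+ 1)) := :- E.denom (E.η^ 1)) ≃-refl TP UP)
  (solve 2 (λ t u → let module E = Expr t u in con (+ 1) :* u := E.numer (E.η^ 1)) ≃-refl TP UP)
  (≐-self (b 1)))
b-tail-≐ (suc m) i = subst (_≐ _ ÷ _) (sym (cf-periodic₂ b-odd b-even i m)) (≐-negate (≐-resp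
  (solve 4 (λ c d t u → let module E = Expr t u in
     numᴱ (negᴱ (ιᴱ t *ᴱ invᴱ (ιᴱ u)) +ᴱ invᴱ (ιᴱ t +ᴱ invᴱ (:- E.denom (c , d) /ᴱ E.numer (c , d))))
       := :- (:- E.denom (E.η E.⊗ (c , d))))
     ≃-refl (proj₁ z) (proj₂ z) TP UP)
  (solve 4 (λ c d t u → let module E = Expr t u in
     denᴱ (negᴱ (ιᴱ t *ᴱ invᴱ (ιᴱ u)) +ᴱ invᴱ (ιᴱ t +ᴱ invᴱ (:- E.denom (c , d) /ᴱ E.numer (c , d))))
       := :- E.numer (E.η E.⊗ (c , d)))
     ≃-refl (proj₁ z) (proj₂ z) TP UP)
  (+inv-≐ (≐-self (b 1)) (+inv-≐ (≐-self (b 2)) (b-tail-≐ m (suc i))))))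
  where
  z : Poly × Poly
  z = η^ (suc m)

cf-a-≐ : ∀ m → cf a 0 (suc (double m)) ≐ numer (η^ (suc m)) ÷ denom (η^ (suc m))
cf-a-≐ m = ≐-resp (*-identityʳ (numer (η^ (suc m)))) (*-identityˡ (denom (η^ (suc m)))) (+inv-≐ (≐-self 0C) (a-tail-≐ m 0))

cf-b-≐ : ∀ m → cf b 0 (suc (double m)) ≐ TP *P denom (η^ (suc m)) -P numer (η^ (suc m)) ÷ denom (η^ (suc m))
cf-b-≐ m = ≐-negate (≐-resp
  (solve 3 (λ t p q → t :* (:- q) :+ p :* con (+ 1) := :- (t :* q :- p)) ≃-refl TP (numer (η^ (suc m))) (denom (η^ (suc m))))
  (solve 1 (λ q → con (+ 1) :* (:- q) := :- q) ≃-refl (denom (η^ (suc m))))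
  (+inv-≐ (≐-self Tc) (b-tail-≐ m 0)))

-- Every division is by a nonzero element

-- At T = 1, U = 0 the Newton map is X ↦ X² / (2X − 1), which fixes 0 and 1 where 2X − 1 = ±1, and the
-- entries a₁ = T / U, a₂ = −T become ∞ and −1, so every continued-fraction tail becomes ∞ with numerator ±1.

infix 4 _≡₁₀_

record _≡₁₀_ (x y : C) : Set where
  constructor _,_
  field
    num≡ : ev₁₀ (num x) ≡ ev₁₀ (num y)
    den≡ : ev₁₀ (den x) ≡ ev₁₀ (den y)

≡₁₀-trans : ∀ {x y z} → x ≡₁₀ y → y ≡₁₀ z → x ≡₁₀ z
≡₁₀-trans (n≡ , d≡) (n≡' , d≡') = trans n≡ n≡' , trans d≡ d≡'

≡₁₀-Nonzero : ∀ {x y} → x ≡₁₀ y → ev₁₀ (num y) ≢ 0ℤ → Nonzero x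
≡₁₀-Nonzero {x} (n≡ , _) y≢0 = ev₁₀≢0⇒Nonzero x (y≢0 ∘ trans (sym n≡))

module _ {x y : C} (x≡y : x ≡₁₀ y) where

  private
    X : Cᴱ 4
    X = var (# 0) /ᴱ var (# 1)
    t u : Polynomial 4
    t = var (# 2)
    u = var (# 3)
    env : VecPointwise (λ p p' → ev₁₀ p ≡ ev₁₀ p') (num x ∷ den x ∷ TP ∷ UP ∷ []) (num y ∷ den y ∷ TP ∷ UP ∷ [])
    env = _≡₁₀_.num≡ x≡y ∷ _≡₁₀_.den≡ x≡y ∷ refl ∷ refl ∷ []

  F-≡₁₀ : F x ≡₁₀ F y
  F-≡₁₀ = ev₁₀-⟦⟧ (numᴱ (Fᴱ t u X)) env , ev₁₀-⟦⟧ (denᴱ (Fᴱ t u X)) env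

  df-≡₁₀ : df x ≡₁₀ df y
  df-≡₁₀ = ev₁₀-⟦⟧ (numᴱ (dfᴱ t u X)) env , ev₁₀-⟦⟧ (denᴱ (dfᴱ t u X)) env

iterF-0-≡₁₀ : ∀ n → iterF n 0C ≡₁₀ 0C ⊎ iterF n 0C ≡₁₀ 0P / constP -1ℤ
iterF-0-≡₁₀ zero = inj₁ (refl , refl)
iterF-0-≡₁₀ (suc n) with iterF-0-≡₁₀ n
... | inj₁ x≡0 = inj₂ (≡₁₀-trans (F-≡₁₀ x≡0) (refl , refl))
... | inj₂ x≡0 = inj₁ (≡₁₀-trans (F-≡₁₀ x≡0) (refl , refl))

iterF-0-defined : ∀ n → IterDefined n 0C
iterF-0-defined zero    = tt
iterF-0-defined (suc n) = iterF-0-defined n , df-nonzero (iterF-0-≡₁₀ n)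
  where
  df-nonzero : iterF n 0C ≡₁₀ 0C ⊎ iterF n 0C ≡₁₀ 0P / constP -1ℤ → Nonzero (df (iterF n 0C))
  df-nonzero (inj₁ x≡) = ≡₁₀-Nonzero (df-≡₁₀ x≡) λ ()
  df-nonzero (inj₂ x≡) = ≡₁₀-Nonzero (df-≡₁₀ x≡) λ ()

iterF-T-≡₁₀ : ∀ n → iterF n Tc ≡₁₀ Tc
iterF-T-≡₁₀ zero    = refl , refl
iterF-T-≡₁₀ (suc n) = ≡₁₀-trans (F-≡₁₀ (iterF-T-≡₁₀ n)) (refl , refl)

iterF-T-defined : ∀ n → IterDefined n Tc
iterF-T-defined zero    = tt
iterF-T-defined (suc n) = iterF-T-defined n , ≡₁₀-Nonzero (df-≡₁₀ (iterF-T-≡₁₀ n)) λ ()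

PoleAt₁₀ : C → Set
PoleAt₁₀ x = ev₁₀ (den x) ≡ 0ℤ × ∣ ev₁₀ (num x) ∣ ≡ 1

∣ev₁₀∣≡1⇒Nonzero : ∀ x → ∣ ev₁₀ (num x) ∣ ≡ 1 → Nonzero x
∣ev₁₀∣≡1⇒Nonzero x ∣x∣≡1 = ev₁₀≢0⇒Nonzero x λ x≡0 → case trans (sym ∣x∣≡1) (cong ∣_∣ x≡0) of λ ()

∣num-+inv∣ : ∀ x y → ev₁₀ (den y) *ℤ ev₁₀ (den x) ≡ 0ℤ →
             ∣ ev₁₀ (num (x + inv y)) ∣ ≡ ∣ ev₁₀ (num x) ∣ ℕ.* ∣ ev₁₀ (num y) ∣
∣num-+inv∣ x y dd≡0 = begin
  ∣ ev₁₀ (num x *P num y +P den y *P den x) ∣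
    ≡⟨ cong ∣_∣ (ev₁₀-+P (num x *P num y) (den y *P den x)) ⟩
  ∣ ev₁₀ (num x *P num y) +ℤ ev₁₀ (den y *P den x) ∣
    ≡⟨ cong₂ (λ n m → ∣ n +ℤ m ∣) (ev₁₀-*P (num x) (num y)) (trans (ev₁₀-*P (den y) (den x)) dd≡0) ⟩
  ∣ ev₁₀ (num x) *ℤ ev₁₀ (num y) +ℤ 0ℤ ∣
    ≡⟨ cong ∣_∣ (ℤP.+-identityʳ (ev₁₀ (num x) *ℤ ev₁₀ (num y))) ⟩
  ∣ ev₁₀ (num x) *ℤ ev₁₀ (num y) ∣
    ≡⟨ ℤP.abs-* (ev₁₀ (num x)) (ev₁₀ (num y)) ⟩
  ∣ ev₁₀ (num x) ∣ ℕ.* ∣ ev₁₀ (num y) ∣ ∎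
  where open ≡-Reasoning

cf-tail-defined : ∀ {c α β} → (∀ i → c (suc (double i)) ≡ α) → (∀ i → c (suc (suc (double i))) ≡ β) →
                  PoleAt₁₀ α → ∣ ev₁₀ (num β) ∣ ≡ 1 →
                  ∀ m i → CFDefined c (suc (double i)) (double m) × PoleAt₁₀ (cf c (suc (double i)) (double m))
cf-tail-defined {c} {α} {β} odd even (dα≡0 , ∣α∣≡1) ∣β∣≡1 = tails
  where
  tails : ∀ m i → CFDefined c (suc (double i)) (double m) × PoleAt₁₀ (cf c (suc (double i)) (double m))
  tails zero    i = tt , subst PoleAt₁₀ (sym (odd i)) (dα≡0 , ∣α∣≡1)
  tails (suc m) i with tails m (suc i)
  ... | t-defined , (dt≡0 , ∣t∣≡1) =
      ( (t-defined , ∣ev₁₀∣≡1⇒Nonzero t ∣t∣≡1)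
      , subst (λ γ → Nonzero (γ + inv t)) (sym (even i)) (∣ev₁₀∣≡1⇒Nonzero w ∣w∣≡1) )
    , subst PoleAt₁₀ (sym (cf-periodic₂ odd even i m))
        ( trans (ev₁₀-*P (den α) (num w)) (cong (_*ℤ ev₁₀ (num w)) dα≡0)
        , trans (∣num-+inv∣ α w (trans (cong (ev₁₀ (den w) *ℤ_) dα≡0) (ℤP.*-zeroʳ (ev₁₀ (den w)))))
                (cong₂ ℕ._*_ ∣α∣≡1 ∣w∣≡1) )
    where
    t w : C
    t = cf c (suc (double (suc i))) (double m)
    w = β + inv t
    ∣w∣≡1 : ∣ ev₁₀ (num w) ∣ ≡ 1
    ∣w∣≡1 = trans (∣num-+inv∣ β t (cong (_*ℤ ev₁₀ (den β)) dt≡0)) (cong₂ ℕ._*_ ∣β∣≡1 ∣t∣≡1)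

cf-defined : ∀ {c α β} → (∀ i → c (suc (double i)) ≡ α) → (∀ i → c (suc (suc (double i))) ≡ β) →
             PoleAt₁₀ α → ∣ ev₁₀ (num β) ∣ ≡ 1 → ∀ m → CFDefined c 0 (suc (double m))
cf-defined {c} odd even α-pole ∣β∣≡1 m =
  let tail-defined , (_ , ∣tail∣≡1) = cf-tail-defined odd even α-pole ∣β∣≡1 m 0
  in  tail-defined , ∣ev₁₀∣≡1⇒Nonzero (cf c 1 (double m)) ∣tail∣≡1

2^n≡suc : ∀ n → Σ ℕ λ m → 2 ^ n ≡ suc m
2^n≡suc zero    = 0 , refl
2^n≡suc (suc n) = let m , 2^n≡1+m = 2^n≡suc n in m ℕ.+ suc (m ℕ.+ 0) , cong (λ k → k ℕ.+ (k ℕ.+ 0)) 2^n≡1+m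

lastIdx≡ : ∀ n m → 2 ^ n ≡ suc m → lastIdx n ≡ suc (double m)
lastIdx≡ n m 2^n≡1+m = begin
  lastIdx n                  ≡⟨ cong (λ k → k ℕ.+ (k ℕ.+ 0) ℕ.∸ 1) 2^n≡1+m ⟩
  m ℕ.+ suc (m ℕ.+ 0)        ≡⟨ cong (λ k → m ℕ.+ suc k) (ℕP.+-identityʳ m) ⟩
  m ℕ.+ suc m                ≡⟨ ℕP.+-suc m m ⟩
  suc (m ℕ.+ m)              ≡⟨ cong suc (double≡+ m) ⟨
  suc (double m)             ∎
  where
  open ≡-Reasoning
  double≡+ : ∀ m → double m ≡ m ℕ.+ m
  double≡+ zero    = refl
  double≡+ (suc m) = cong suc (trans (cong suc (double≡+ m)) (sym (ℕP.+-suc m m)))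

theorem6p1 : (n : ℕ) →
    ((IterDefined (suc n) 0C × iterF (suc n) 0C ≈ S n)
    × (CFDefined a 0 (lastIdx n) × cf a 0 (lastIdx n) ≈ S n))
    × ((IterDefined (suc n) Tc × iterF (suc n) Tc ≈ Tc - S n)
    × (CFDefined b 0 (lastIdx n) × cf b 0 (lastIdx n) ≈ Tc - S n))
theorem6p1 n =
    ( (iterF-0-defined (suc n) , ≐∧≋⇒≈ (iterF-0-≐ n) (S-≋ n))
    , at-lastIdx a (S n) (cf-defined a-odd a-even (refl , refl) refl m , ≐∧≋⇒≈ (cf-a-≐ m) S≋) )
  , ( (iterF-T-defined (suc n) , ≐∧≋⇒≈ (iterF-T-≐ n) (T-minus-≋ (S-≋ n)))
    , at-lastIdx b (Tc - S n) (cf-defined b-odd b-even (refl , refl) refl m , ≐∧≋⇒≈ (cf-b-≐ m) (T-minus-≋ S≋)) )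
  where
  m : ℕ
  m = proj₁ (2^n≡suc n)
  S≋ : S n ≋ numer (η^ (suc m)) ÷ denom (η^ (suc m))
  S≋ = subst (λ z → S n ≋ numer z ÷ denom z) (cong η^ (proj₂ (2^n≡suc n))) (S-≋ n)
  at-lastIdx : ∀ c y → CFDefined c 0 (suc (double m)) × cf c 0 (suc (double m)) ≈ y
                     → CFDefined c 0 (lastIdx n) × cf c 0 (lastIdx n) ≈ y
  at-lastIdx c y = subst (λ L → CFDefined c 0 L × cf c 0 L ≈ y) (sym (lastIdx≡ n m (proj₂ (2^n≡suc n))))
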